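{- Let $G$ be a system and $u$ a node of $G$ with $\deg_G(u)=t$. If $F$ is a conditional faulty set of $G$ with $|F|\leq t$, then for every outcome of the tests consistent with the BGM model for the faulty set $F$, the algorithm CLDA$(G,u,t)$ returns $1$ if $u\in F$ and $0$ if $u\notin F$; that is, the faulty/fault-free status of $u$ is identified accurately by CLDA$(G,u,t)$.
   Context: A system is a finite simple undirected graph $G=(V,E)$. For adjacent nodes $a,b$, the test $(a,b)$ ($a$ tests $b$) yields $\sigma(a,b)\in\{0,1\}$. BGM model for a faulty set $F\subseteq V$: if $a\notin F$ then $\sigma(a,b)=1$ iff $b\in F$; if $a,b\in F$ then $\sigma(a,b)=1$; if $a\in F$ and $b\notin F$ then $\sigma(a,b)$ may be $0$ or $1$ (arbitrary). A set $F\subseteq V$ is a conditional faulty set if $N_G(v)\not\subseteq F$ for every node $v\in V-F$, where $N_G(v)$ is the set of neighbors of $v$. Algorithm CLDA$(G,u,t)$: let $N_G(u)=\{v_1,\ldots,v_t\}$; perform the tests $(u,v_i)$ and $(v_i,u)$ for every $1\leq i\leq t$; return $0$ if there is some $i$ with $\sigma(u,v_i)=0$ and $\sigma(v_i,u)=0$, and return $1$ otherwise. -}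

module Defs where

open import Data.Nat using (ℕ; _≤_)
open import Data.Bool using (Bool; true; false; _∧_; _∨_; not; T)
open import Data.Fin using (Fin)
open import Data.Fin.Subset using (Subset; _∈_; _∉_; ∣_∣)
open import Data.List using (List; filter; length; map)
open import Data.Bool.ListAction using (any)
open import Data.List.Membership.Propositional using () renaming (_∈_ to _∈ₗ_)
open import Data.Vec.Functional using ()
open import Data.Fin.Base using ()
open import Data.List.Base using ()
open import Data.Product using (Σ; _×_; ∃-syntax; _,_)
open import Relation.Binary.PropositionalEquality using (_≡_)
open import Relation.Nullary using (¬_)
open import Relation.Nullary.Decidable using (does)
import Data.List as L
import Data.Fin as F

-- A system: a finite simple undirected graph on the node set Fin n,
-- given by a Boolean adjacency matrix that is symmetric and irreflexive.
record Graph (n : ℕ) : Set where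
  field
    adj      : Fin n → Fin n → Bool
    symmetric  : ∀ a b → adj a b ≡ adj b a
    irreflexive : ∀ a → adj a a ≡ false
open Graph public

neighbours : ∀ {n} → Graph n → Fin n → List (Fin n)
neighbours G v = L.filter (λ w → T? (adj G v w)) (L.allFin _)
  where
  open import Data.Bool.Properties using (T?)

deg : ∀ {n} → Graph n → Fin n → ℕ
deg G v = length (neighbours G v)

-- A test outcome (syndrome): σ a b is the result of a testing b
-- (only its values on adjacent pairs are relevant).
Syndrome : ℕ → Set
Syndrome n = Fin n → Fin n → Bool

inF : ∀ {n} → Subset n → Fin n → Bool
inF F v = Data.Vec.lookup F v
  where import Data.Vec

BGM : ∀ {n} → Graph n → Subset n → Syndrome n → Set
BGM G F σ =
  ∀ a b → adj G a b ≡ true →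
    (a ∉ F → σ a b ≡ inF F b) ×
    (a ∈ F → b ∈ F → σ a b ≡ true)

ConditionalFaulty : ∀ {n} → Graph n → Subset n → Set
ConditionalFaulty G F =
  ∀ v → v ∉ F → ∃[ w ] (adj G v w ≡ true × w ∉ F)

-- Algorithm CLDA(G,u,t): tests (u,v_i) and (v_i,u) for every neighbour v_i
-- of u; returns 0 (false) if some i has σ(u,v_i)=0 and σ(v_i,u)=0,
-- and 1 (true) otherwise.
CLDA : ∀ {n} → Graph n → Syndrome n → Fin n → Bool
CLDA G σ u =
  not (any (λ v → not (σ u v) ∧ not (σ v u)) (neighbours G u))

{-# OPTIONS --safe #-}
module Submission where

-- If u is faulty, every test between u and a neighbour v has a faulty tester
-- facing a faulty node or a fault-free tester facing the faulty u, so some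
-- direction reads 1 and CLDA returns 1. If u is fault-free, the conditional
-- faulty property supplies a fault-free neighbour w, and both tests between u
-- and w read 0, so CLDA returns 0.

open import Defs
open import Data.Nat using (ℕ; _≤_)
open import Data.Fin using (Fin)
open import Data.Fin.Subset using (Subset; _∈_; _∉_; ∣_∣)
open import Data.Fin.Subset.Properties using (_∈?_)
open import Data.Bool using (Bool; true; false; not; _∧_; T)
open import Data.Bool.Properties using (T?; T-≡; ∧-zeroʳ)
open import Data.Bool.ListAction using (any)
open import Data.List using (List; []; _∷_; allFin)
open import Data.List.Membership.Propositional using (lose) renaming (_∈_ to _∈ₗ_)
open import Data.List.Membership.Propositional.Properties using (∈-filter⁺; ∈-filter⁻; ∈-allFin)
open import Data.List.Relation.Unary.Any using (here; there)
open import Data.List.Relation.Unary.Any.Properties using (any⁺)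
open import Data.Vec.Properties using ([]=⇒lookup; lookup⇒[]=)
open import Data.Product using (_×_; _,_; proj₁; proj₂)
open import Function using (_∘_; Equivalence)
open import Relation.Binary.PropositionalEquality using (_≡_; refl; cong; trans)
open import Relation.Nullary using (yes; no; contradiction)

not-any≡true : ∀ {A : Set} {p : A → Bool} {xs : List A} →
  (∀ {x} → x ∈ₗ xs → p x ≡ false) → not (any p xs) ≡ true
not-any≡true {xs = []}    _    = refl
not-any≡true {xs = x ∷ _} none rewrite none (here refl) = not-any≡true (none ∘ there)

not-any≡false : ∀ {A : Set} {p : A → Bool} {xs : List A} {x : A} →
  x ∈ₗ xs → p x ≡ true → not (any p xs) ≡ false
not-any≡false {p = p} x∈xs px =
  cong not (Equivalence.to T-≡ (any⁺ p (lose {P = T ∘ p} x∈xs (Equivalence.from T-≡ px))))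

inF-∈ : ∀ {n} {F : Subset n} {v : Fin n} → v ∈ F → inF F v ≡ true
inF-∈ = []=⇒lookup

inF-∉ : ∀ {n} {F : Subset n} {v : Fin n} → v ∉ F → inF F v ≡ false
inF-∉ {F = F} {v} v∉F with inF F v in eq
... | false = refl
... | true  = contradiction (lookup⇒[]= v F eq) v∉F

module _ {n} (G : Graph n) where

  adj-sym : ∀ {a b} → adj G a b ≡ true → adj G b a ≡ true
  adj-sym {a} {b} ab = trans (symmetric G b a) ab

  ∈-neighbours⁺ : ∀ {u v} → adj G u v ≡ true → v ∈ₗ neighbours G u
  ∈-neighbours⁺ {u} {v} uv =
    ∈-filter⁺ (λ w → T? (adj G u w)) (∈-allFin v) (Equivalence.from T-≡ uv)

  ∈-neighbours⁻ : ∀ {u v} → v ∈ₗ neighbours G u → adj G u v ≡ true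
  ∈-neighbours⁻ {u} v∈N =
    Equivalence.to T-≡ (proj₂ (∈-filter⁻ (λ w → T? (adj G u w)) {xs = allFin n} v∈N))

-- Definitionally the predicate that CLDA evaluates on each neighbour v of u.
bothTestsZero : ∀ {n} → Syndrome n → Fin n → Fin n → Bool
bothTestsZero σ u v = not (σ u v) ∧ not (σ v u)

module BGM-Properties {n} (G : Graph n) (F : Subset n) (σ : Syndrome n) (bgm : BGM G F σ) where

  faulty⇒¬bothTestsZero : ∀ {u v} → u ∈ F → adj G u v ≡ true →
    bothTestsZero σ u v ≡ false
  faulty⇒¬bothTestsZero {u} {v} u∈F uv with v ∈? F
  ... | yes v∈F rewrite proj₂ (bgm u v uv) u∈F v∈F = refl
  ... | no  v∉F rewrite proj₁ (bgm v u (adj-sym G uv)) v∉F | inF-∈ u∈F = ∧-zeroʳ (not (σ u v))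

  faultFree⇒bothTestsZero : ∀ {u w} → u ∉ F → w ∉ F → adj G u w ≡ true →
    bothTestsZero σ u w ≡ true
  faultFree⇒bothTestsZero u∉F w∉F uw
    rewrite proj₁ (bgm _ _ uw) u∉F | proj₁ (bgm _ _ (adj-sym G uw)) w∉F
          | inF-∉ u∉F | inF-∉ w∉F = refl

theorem5p2 : ∀ {n} (G : Graph n) (u : Fin n) (t : ℕ) → deg G u ≡ t →
    (F : Subset n) → ConditionalFaulty G F → ∣ F ∣ ≤ t →
    (σ : Syndrome n) → BGM G F σ →
    (u ∈ F → CLDA G σ u ≡ true) × (u ∉ F → CLDA G σ u ≡ false)
theorem5p2 G u _ _ F conditional _ σ bgm = faulty , faultFree
  where
  open BGM-Properties G F σ bgm

  faulty : u ∈ F → CLDA G σ u ≡ true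
  faulty u∈F = not-any≡true (faulty⇒¬bothTestsZero u∈F ∘ ∈-neighbours⁻ G)

  faultFree : u ∉ F → CLDA G σ u ≡ false
  faultFree u∉F =
    let w , uw , w∉F = conditional u u∉F
    in  not-any≡false (∈-neighbours⁺ G uw) (faultFree⇒bothTestsZero u∉F w∉F uw)
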